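{- Let $n\ge 1$. A transposition $\delta_{i,j,k}$ (with $1\le i<j<k\le n+1$) is a tree transposition if and only if it is a $1$-transposition, i.e. $j=i+1$ or $k=j+1$.
   Context: For a permutation $\sigma$ of $[n]$ (viewed as the sequence $\sigma(1),\dots,\sigma(n)$) and integers $1\le i<j<k\le n+1$, let $q=k+i-j$; the transposition $\delta_{i,j,k}$ applied to $\sigma$ gives the sequence $\delta$ with $\delta(t)=\sigma(t)$ for $1\le t<i$, $\delta(t)=\sigma(t+j-i)$ for $i\le t<q$, $\delta(t)=\sigma(t+j-k)$ for $q\le t<k$, and $\delta(t)=\sigma(t)$ for $k\le t\le n$ (i.e. it swaps the consecutive blocks $\sigma(i..j-1)$ and $\sigma(j..k-1)$). It is a $1$-transposition if $j=i+1$ or $k=j+1$. A full binary tree is a rooted ordered tree in which every node is either a leaf or an internal node with exactly two children. Given one with $n$ internal nodes, label its internal nodes $1,\dots,n$ so that the in-order traversal is $1,\dots,n$; its associated permutation is the sequence of labels in pre-order traversal. A rotation: a right rotation at an internal node $a$ whose left child $b$ is internal, with $C,D$ the subtrees of $b$ and $E$ the right subtree of $a$, replaces the subtree at $a$ by the tree with root $b$, left subtree $C$, right child $a$ having subtrees $D,E$; a left rotation is the inverse. The rotation distance $d(T_1,T_2)$ is the minimum number of rotations transforming $T_1$ into $T_2$. A transposition $\delta_{i,j,k}$ is a tree transposition if there exist full binary trees $T_1,T_2$ with $n$ internal nodes and associated permutations $\sigma,\tau$ such that $d(T_1,T_2)=1$ and applying $\delta_{i,j,k}$ to $\sigma$ yields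 $\tau$. -}

module Defs where

open import Data.Nat using (ℕ; zero; suc; _+_; _∸_)
open import Data.List using (List; []; _∷_; _++_; take; drop)
open import Data.Product using (∃; ∃-syntax; _×_)
open import Relation.Binary.PropositionalEquality using (_≡_)
open import Relation.Nullary using (¬_)

data Tree : Set where
  leaf : Tree
  node : Tree → Tree → Tree

size : Tree → ℕ
size leaf = 0
size (node l r) = suc (size l + size r)

-- Pre-order sequence of labels, where internal nodes are labelled by in-order
-- position.  `pre o t` labels the internal nodes of t by o+1, …, o+size t.
pre : ℕ → Tree → List ℕ
pre o leaf = []
pre o (node l r) = suc (o + size l) ∷ (pre o l ++ pre (suc (o + size l)) r)

perm : Tree → List ℕ
perm t = pre 0 t

data Rotation : Tree → Tree → Set where
  rotR : (C D E : Tree) → Rotation (node (node C D) E) (node C (node D E))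
  rotL : (C D E : Tree) → Rotation (node C (node D E)) (node (node C D) E)
  inL  : {A A' : Tree} (B : Tree) → Rotation A A' → Rotation (node A B) (node A' B)
  inR  : (A : Tree) {B B' : Tree} → Rotation B B' → Rotation (node A B) (node A B')

RotDist1 : Tree → Tree → Set
RotDist1 T₁ T₂ = ¬ (T₁ ≡ T₂) × Rotation T₁ T₂

-- δ_{i,j,k} (1-based positions): swaps the blocks σ(i..j-1) and σ(j..k-1)
δ : ℕ → ℕ → ℕ → List ℕ → List ℕ
δ i j k σ =
  take (i ∸ 1) σ
  ++ drop (j ∸ 1) (take (k ∸ 1) σ)
  ++ drop (i ∸ 1) (take (j ∸ 1) σ)
  ++ drop (k ∸ 1) σ

TreeTransposition : ℕ → ℕ → ℕ → ℕ → Set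
TreeTransposition n i j k =
  ∃[ T₁ ] ∃[ T₂ ] (size T₁ ≡ n × size T₂ ≡ n × RotDist1 T₁ T₂
                   × δ i j k (perm T₁) ≡ perm T₂)

-- A rotation changes the pre-order word of a tree by letting a single label
-- jump forward over a block (rotating node (node C D) E at its root makes the
-- root label jump over l ∷ pre C), so an entry among the first m of one word is
-- among the first m + 1 of the other.  If τ = δ σ swaps blocks U, V of length
-- at least 2, the head of V directly follows the common prefix P in τ, but it is
-- not among P ++ take 2 U, the first |P| + 2 entries of σ, as labels are
-- distinct; so no jump leads from τ to σ, and symmetrically none from σ to τ.
-- Conversely that root rotation swaps a single label with the block l ∷ pre C,
-- and hanging the tree below a spine of a left leaves moves the swap to
-- position a + 1.
module Submission where

open import Defs
open import Data.Nat using (ℕ; zero; suc; _+_; _∸_; _⊓_; _≤_; _<_; z≤n; s≤s)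
open import Data.Nat.Properties
  using (+-identityʳ; +-suc; +-assoc; +-comm; m≤m+n; n≤1+n; ≤-trans; <-trans; <⇒≤; <-irrefl; m≤n⇒m⊓n≡m;
         m≤n⇒∃[o]m+o≡n; suc-injective)
open import Data.Nat.Tactic.RingSolver using (solve-∀)
open import Data.List using (List; []; _∷_; _++_; take; drop; length)
open import Data.List.Properties using (++-assoc; length-++; length-take; length-drop; take++drop≡id)
open import Data.List.Membership.Propositional using (_∈_; _∉_)
open import Data.List.Membership.Propositional.Properties using (∈-++⁺ˡ; ∈-++⁺ʳ; ∈-++⁻)
open import Data.List.Relation.Unary.Any using (here; there)
import Data.List.Relation.Unary.All as All
open import Data.List.Relation.Unary.AllPairs using ([]; _∷_)
open import Data.List.Relation.Unary.Unique.Propositional using (Unique)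
open import Data.List.Relation.Unary.Unique.Propositional.Properties
  using (Unique[x∷xs]⇒x∉xs) renaming (++⁺ to Unique-++⁺)
open import Data.Product using (∃-syntax; _×_; _,_; proj₁; proj₂)
open import Data.Sum using (_⊎_; inj₁; inj₂)
import Data.Sum as Sum
open import Data.Empty using (⊥-elim)
open import Relation.Nullary using (¬_)
open import Function.Bundles using (_⇔_; mk⇔)
open import Relation.Binary.PropositionalEquality
  using (_≡_; _≢_; refl; sym; trans; cong; cong₂; subst; subst₂; module ≡-Reasoning)

private
  variable
    A : Set
    x : A
    xs ys : List A
    a b c n i j k : ℕ
    t u : Tree

m<n∧n∸m≤1⇒n≡1+m : a < b → b ∸ a ≤ 1 → b ≡ suc a
m<n∧n∸m≤1⇒n≡1+m {zero}  (s≤s z≤n) (s≤s z≤n) = refl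
m<n∧n∸m≤1⇒n≡1+m {suc a} (s≤s a<b) b∸a≤1     = cong suc (m<n∧n∸m≤1⇒n≡1+m a<b b∸a≤1)

suc[m+n]+o≡m+suc[n+o] : ∀ m n o → suc (m + n) + o ≡ m + suc (n + o)
suc[m+n]+o≡m+suc[n+o] m n o = trans (cong suc (+-assoc m n o)) (sym (+-suc m (n + o)))

take-length-++ : ∀ (xs : List A) ys → take (length xs) (xs ++ ys) ≡ xs
take-length-++ []       ys = refl
take-length-++ (x ∷ xs) ys = cong (x ∷_) (take-length-++ xs ys)

drop-length-++ : ∀ (xs : List A) ys → drop (length xs) (xs ++ ys) ≡ ys
drop-length-++ []       ys = refl
drop-length-++ (x ∷ xs) ys = drop-length-++ xs ys

take-length+-++ : ∀ (xs : List A) m ys → take (length xs + m) (xs ++ ys) ≡ xs ++ take m ys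
take-length+-++ []       m ys = refl
take-length+-++ (x ∷ xs) m ys = cong (x ∷_) (take-length+-++ xs m ys)

drop-length+-++ : ∀ (xs : List A) m ys → drop (length xs + m) (xs ++ ys) ≡ drop m ys
drop-length+-++ []       m ys = refl
drop-length+-++ (x ∷ xs) m ys = drop-length+-++ xs m ys

take-++-drop-take : a ≤ b → (xs : List A) → take a xs ++ drop a (take b xs) ≡ take b xs
take-++-drop-take z≤n       xs       = refl
take-++-drop-take (s≤s a≤b) []       = refl
take-++-drop-take (s≤s a≤b) (x ∷ xs) = cong (x ∷_) (take-++-drop-take a≤b xs)

split-blocks : a ≤ b → b ≤ c → (xs : List A) →
  xs ≡ take a xs ++ drop a (take b xs) ++ drop b (take c xs) ++ drop c xs
split-blocks {a = a} {b = b} {c = c} {A = A} a≤b b≤c xs = begin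
  xs                                    ≡⟨ sym (take++drop≡id c xs) ⟩
  take c xs ++ S                        ≡⟨ cong (_++ S) (sym (take-++-drop-take b≤c xs)) ⟩
  (take b xs ++ V) ++ S                 ≡⟨ cong (λ ys → (ys ++ V) ++ S) (sym (take-++-drop-take a≤b xs)) ⟩
  ((P ++ U) ++ V) ++ S                  ≡⟨ ++-assoc (P ++ U) V S ⟩
  (P ++ U) ++ V ++ S                    ≡⟨ ++-assoc P U (V ++ S) ⟩
  P ++ U ++ V ++ S                      ∎
  where
  open ≡-Reasoning
  P U V S : List A
  P = take a xs
  U = drop a (take b xs)
  V = drop b (take c xs)
  S = drop c xs

length-drop-take : ∀ a (xs : List A) → b ≤ length xs → length (drop a (take b xs)) ≡ b ∸ a
length-drop-take {b = b} a xs b≤ = begin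
  length (drop a (take b xs))  ≡⟨ length-drop a (take b xs) ⟩
  length (take b xs) ∸ a       ≡⟨ cong (_∸ a) (length-take b xs) ⟩
  b ⊓ length xs ∸ a            ≡⟨ cong (_∸ a) (m≤n⇒m⊓n≡m b≤) ⟩
  b ∸ a                        ∎
  where open ≡-Reasoning

δ-swaps-blocks : ∀ {σ} P U V S → σ ≡ P ++ U ++ V ++ S →
  i ≡ suc (length P) → j ≡ i + length U → k ≡ j + length V → δ i j k σ ≡ P ++ V ++ U ++ S
δ-swaps-blocks (p ∷ P) U V S refl refl refl refl = cong (p ∷_) (δ-swaps-blocks P U V S refl refl refl refl)
δ-swaps-blocks []      U V S refl refl refl refl = cong₂ _++_ block-V (cong₂ _++_ block-U block-S)
  where
  block-V : drop (length U) (take (length U + length V) (U ++ V ++ S)) ≡ V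
  block-V = trans (cong (drop (length U)) (take-length+-++ U (length V) (V ++ S)))
                  (trans (drop-length-++ U _) (take-length-++ V S))
  block-U : take (length U) (U ++ V ++ S) ≡ U
  block-U = take-length-++ U (V ++ S)
  block-S : drop (length U + length V) (U ++ V ++ S) ≡ S
  block-S = trans (drop-length+-++ U (length V) (V ++ S)) (drop-length-++ V S)

Unique[xs++x∷ys]⇒x∉xs++ys : ∀ (xs ys : List A) → Unique (xs ++ x ∷ ys) → x ∉ xs ++ ys
Unique[xs++x∷ys]⇒x∉xs++ys []       ys u                = Unique[x∷xs]⇒x∉xs u
Unique[xs++x∷ys]⇒x∉xs++ys (y ∷ xs) ys (y∉ ∷ _) (here refl) = All.lookup y∉ (∈-++⁺ʳ xs (here refl)) refl
Unique[xs++x∷ys]⇒x∉xs++ys (y ∷ xs) ys (_ ∷ u)  (there x∈) = Unique[xs++x∷ys]⇒x∉xs++ys xs ys u x∈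

data Jump {A : Set} : List A → List A → Set where
  jump : ∀ p B (a : A) s → Jump (p ++ B ++ a ∷ s) (p ++ a ∷ B ++ s)

jump-++ˡ : ∀ (zs : List A) → Jump xs ys → Jump (zs ++ xs) (zs ++ ys)
jump-++ˡ zs (jump p B a s) = subst₂ Jump (++-assoc zs p _) (++-assoc zs p _) (jump (zs ++ p) B a s)

jump-++ʳ : ∀ (zs : List A) → Jump xs ys → Jump (xs ++ zs) (ys ++ zs)
jump-++ʳ zs (jump p B a s) = subst₂ Jump
  (sym (trans (++-assoc p (B ++ a ∷ s) zs) (cong (p ++_) (++-assoc B (a ∷ s) zs))))
  (sym (trans (++-assoc p (a ∷ B ++ s) zs) (cong (λ ys → p ++ a ∷ ys) (++-assoc B s zs))))
  (jump p B a (s ++ zs))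

∈-take-suc : ∀ m (xs : List A) → x ∈ take m xs → x ∈ take (suc m) xs
∈-take-suc (suc m) (y ∷ xs) (here x≡y) = here x≡y
∈-take-suc (suc m) (y ∷ xs) (there x∈) = there (∈-take-suc m xs x∈)

∈-take-++-∷ : ∀ m (B : List A) {a} s → x ∈ take m (B ++ a ∷ s) → x ∈ a ∷ take m (B ++ s)
∈-take-++-∷ (suc m) []      s (here x≡a)  = here x≡a
∈-take-++-∷ (suc m) []      s (there x∈)  = there (∈-take-suc m s x∈)
∈-take-++-∷ (suc m) (b ∷ B) s (here x≡b)  = there (here x≡b)
∈-take-++-∷ (suc m) (b ∷ B) s (there x∈) with ∈-take-++-∷ m B s x∈
... | here x≡a = here x≡a
... | there x∈′ = there (there x∈′)

∈-take-jump : Jump xs ys → ∀ m → x ∈ take m xs → x ∈ take (suc m) ys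
∈-take-jump (jump p B a s) = go p
  where
  go : ∀ p m → x ∈ take m (p ++ B ++ a ∷ s) → x ∈ take (suc m) (p ++ a ∷ B ++ s)
  go []      m       x∈          = ∈-take-++-∷ m B s x∈
  go (y ∷ p) (suc m) (here x≡y)  = here x≡y
  go (y ∷ p) (suc m) (there x∈)  = there (go p m x∈)

jump-over-block⇒length≤1 : ∀ (P U V S : List A) {x} → x ∉ P ++ U →
  Jump (P ++ x ∷ V ++ U ++ S) (P ++ U ++ x ∷ V ++ S) → length U ≤ 1
jump-over-block⇒length≤1 P []       V S x∉ _ = z≤n
jump-over-block⇒length≤1 P (_ ∷ []) V S x∉ _ = s≤s z≤n
jump-over-block⇒length≤1 P (u₁ ∷ u₂ ∷ U) V S {x} x∉ j =
  ⊥-elim (x∉ (into-P++U (∈-++⁻ P (subst (x ∈_) prefix (∈-take-jump j (length P + 1) x∈)))))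
  where
  x∈ : x ∈ take (length P + 1) (P ++ x ∷ V ++ u₁ ∷ u₂ ∷ U ++ S)
  x∈ = subst (x ∈_) (sym (take-length+-++ P 1 _)) (∈-++⁺ʳ P (here refl))
  prefix : take (suc (length P + 1)) (P ++ u₁ ∷ u₂ ∷ U ++ x ∷ V ++ S) ≡ P ++ u₁ ∷ u₂ ∷ []
  prefix = trans (cong (λ m → take m (P ++ u₁ ∷ u₂ ∷ U ++ x ∷ V ++ S)) (sym (+-suc (length P) 1)))
                 (take-length+-++ P 2 (u₁ ∷ u₂ ∷ U ++ x ∷ V ++ S))
  into-P++U : x ∈ P ⊎ x ∈ u₁ ∷ u₂ ∷ [] → x ∈ P ++ u₁ ∷ u₂ ∷ U
  into-P++U (inj₁ x∈P) = ∈-++⁺ˡ x∈P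
  into-P++U (inj₂ x∈u) = ∈-++⁺ʳ P (∈-++⁺ˡ x∈u)

swap-jump⇒short-block : ∀ (P U V S : List A) → Unique (P ++ U ++ V ++ S) →
  Jump (P ++ U ++ V ++ S) (P ++ V ++ U ++ S) ⊎ Jump (P ++ V ++ U ++ S) (P ++ U ++ V ++ S) →
  length U ≤ 1 ⊎ length V ≤ 1
swap-jump⇒short-block P []       V        S _ _ = inj₁ z≤n
swap-jump⇒short-block P (u ∷ U)  []       S _ _ = inj₂ z≤n
swap-jump⇒short-block P (u ∷ U)  (v ∷ V)  S uniq (inj₁ j) =
  inj₂ (jump-over-block⇒length≤1 P (v ∷ V) U S u∉ j)
  where
  u∉ : u ∉ P ++ v ∷ V
  u∉ u∈ with ∈-++⁻ P u∈
  ... | inj₁ u∈P = Unique[xs++x∷ys]⇒x∉xs++ys P _ uniq (∈-++⁺ˡ u∈P)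
  ... | inj₂ u∈V = Unique[xs++x∷ys]⇒x∉xs++ys P _ uniq (∈-++⁺ʳ P (∈-++⁺ʳ U (∈-++⁺ˡ u∈V)))
swap-jump⇒short-block P (u ∷ U)  (v ∷ V)  S uniq (inj₂ j) =
  inj₁ (jump-over-block⇒length≤1 P (u ∷ U) V S v∉ j)
  where
  v∉ : v ∉ P ++ u ∷ U
  v∉ v∈ = Unique[xs++x∷ys]⇒x∉xs++ys (P ++ u ∷ U) (V ++ S)
            (subst Unique (sym (++-assoc P (u ∷ U) _)) uniq) (∈-++⁺ˡ v∈)

jump-δ⇒1-transposition : {σ τ : List ℕ} → Unique σ → a < b → b < c → c ≤ length σ →
  Jump σ τ ⊎ Jump τ σ → δ (suc a) (suc b) (suc c) σ ≡ τ → b ≡ suc a ⊎ c ≡ suc b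
jump-δ⇒1-transposition {a = a} {b = b} {c = c} {σ = σ} uniq a<b b<c c≤ js refl =
  Sum.map (λ U≤1 → m<n∧n∸m≤1⇒n≡1+m a<b (subst (_≤ 1) (length-drop-take a σ (≤-trans (<⇒≤ b<c) c≤)) U≤1))
          (λ V≤1 → m<n∧n∸m≤1⇒n≡1+m b<c (subst (_≤ 1) (length-drop-take b σ c≤) V≤1))
          (swap-jump⇒short-block P U V S (subst Unique σ-blocks uniq)
            (subst (λ s → Jump s δσ ⊎ Jump δσ s) σ-blocks js))
  where
  P U V S δσ : List ℕ
  P = take a σ
  U = drop a (take b σ)
  V = drop b (take c σ)
  S = drop c σ
  δσ = P ++ V ++ U ++ S
  σ-blocks : σ ≡ P ++ U ++ V ++ S
  σ-blocks = split-blocks (<⇒≤ a<b) (<⇒≤ b<c) σ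

size-rotation : Rotation t u → size t ≡ size u
size-rotation (rotR C D E) = cong suc (suc[m+n]+o≡m+suc[n+o] (size C) (size D) (size E))
size-rotation (rotL C D E) = cong suc (sym (suc[m+n]+o≡m+suc[n+o] (size C) (size D) (size E)))
size-rotation (inL B r)    = cong (λ s → suc (s + size B)) (size-rotation r)
size-rotation (inR A r)    = cong (λ s → suc (size A + s)) (size-rotation r)

rotation-sym : Rotation t u → Rotation u t
rotation-sym (rotR C D E) = rotL C D E
rotation-sym (rotL C D E) = rotR C D E
rotation-sym (inL B r)    = inL B (rotation-sym r)
rotation-sym (inR A r)    = inR A (rotation-sym r)

rotation-irreflexive : Rotation t u → t ≢ u
rotation-irreflexive (rotR C D E) ()
rotation-irreflexive (rotL C D E) ()
rotation-irreflexive (inL B r)    refl = rotation-irreflexive r refl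
rotation-irreflexive (inR A r)    refl = rotation-irreflexive r refl

length-pre : ∀ o t → length (pre o t) ≡ size t
length-pre o leaf       = refl
length-pre o (node l r) =
  cong suc (trans (length-++ (pre o l)) (cong₂ _+_ (length-pre o l) (length-pre _ r)))

pre-bounds : ∀ o t → x ∈ pre o t → o < x × x ≤ o + size t
pre-bounds o (node l r) = bounds
  where
  top : suc (o + size l) + size r ≡ o + size (node l r)
  top = suc[m+n]+o≡m+suc[n+o] o (size l) (size r)
  o<root : o < suc (o + size l)
  o<root = s≤s (m≤m+n o (size l))
  root≤ : suc (o + size l) ≤ o + size (node l r)
  root≤ = subst (suc (o + size l) ≤_) top (m≤m+n _ (size r))
  bounds : ∀ {x} → x ∈ pre o (node l r) → o < x × x ≤ o + size (node l r)
  bounds (here refl) = o<root , root≤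
  bounds (there x∈) with ∈-++⁻ (pre o l) x∈
  bounds {x} (there x∈) | inj₁ x∈l =
    let (o<x , x≤) = pre-bounds o l x∈l in o<x , ≤-trans (≤-trans x≤ (n≤1+n _)) root≤
  bounds {x} (there x∈) | inj₂ x∈r =
    let (root<x , x≤) = pre-bounds _ r x∈r in <-trans o<root root<x , subst (x ≤_) top x≤

pre-unique : ∀ o t → Unique (pre o t)
pre-unique o leaf       = []
pre-unique o (node l r) =
  All.tabulate root∉ ∷ Unique-++⁺ (pre-unique o l) (pre-unique _ r) disjoint
  where
  root∉ : ∀ {x} → x ∈ pre o l ++ pre (suc (o + size l)) r → suc (o + size l) ≢ x
  root∉ x∈ refl with ∈-++⁻ (pre o l) x∈
  ... | inj₁ x∈l = <-irrefl refl (s≤s (proj₂ (pre-bounds o l x∈l)))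
  ... | inj₂ x∈r = <-irrefl refl (proj₁ (pre-bounds _ r x∈r))
  disjoint : ∀ {x} → ¬ (x ∈ pre o l × x ∈ pre (suc (o + size l)) r)
  disjoint (x∈l , x∈r) =
    <-irrefl refl (≤-trans (s≤s (proj₂ (pre-bounds o l x∈l))) (<⇒≤ (proj₁ (pre-bounds _ r x∈r))))

pre-rotation : ∀ o C D E → ∃[ r ] ∃[ V ] ∃[ R ]
  length V ≡ suc (size C) ×
  pre o (node (node C D) E) ≡ r ∷ V ++ R ×
  pre o (node C (node D E)) ≡ V ++ r ∷ R
pre-rotation o C D E =
  r , l ∷ pre o C , pre l D ++ pre r E ,
  cong suc (length-pre o C) ,
  cong (λ ys → r ∷ l ∷ ys) (++-assoc (pre o C) (pre l D) (pre r E)) ,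
  cong (λ q → l ∷ pre o C ++ q ∷ pre l D ++ pre q E)
       (cong suc (suc[m+n]+o≡m+suc[n+o] o (size C) (size D)))
  where
  l r : ℕ
  l = suc (o + size C)
  r = suc (o + size (node C D))

root-rotation-jump : ∀ o C D E → Jump (pre o (node C (node D E))) (pre o (node (node C D) E))
root-rotation-jump o C D E with pre-rotation o C D E
... | r , V , R , _ , pre₁ , pre₂ = subst₂ Jump (sym pre₂) (sym pre₁) (jump [] V r R)

rotation⇒jump : Rotation t u → ∀ o → Jump (pre o t) (pre o u) ⊎ Jump (pre o u) (pre o t)
rotation⇒jump (rotR C D E) o = inj₂ (root-rotation-jump o C D E)
rotation⇒jump (rotL C D E) o = inj₁ (root-rotation-jump o C D E)
rotation⇒jump (inL {A} B r) o rewrite sym (size-rotation r) =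
  Sum.map extend extend (rotation⇒jump r o)
  where
  m = suc (o + size A)
  extend : ∀ {xs ys} → Jump xs ys → Jump (m ∷ xs ++ pre m B) (m ∷ ys ++ pre m B)
  extend j = jump-++ˡ (m ∷ []) (jump-++ʳ (pre m B) j)
rotation⇒jump (inR A r) o = Sum.map extend extend (rotation⇒jump r m)
  where
  m = suc (o + size A)
  extend : ∀ {xs ys} → Jump xs ys → Jump (m ∷ pre o A ++ xs) (m ∷ pre o A ++ ys)
  extend = jump-++ˡ (m ∷ pre o A)

tree-transposition⇒1-transposition : 1 ≤ i → i < j → j < k → k ≤ suc n →
  TreeTransposition n i j k → j ≡ suc i ⊎ k ≡ suc j
tree-transposition⇒1-transposition {suc a} {suc b} {suc c} (s≤s z≤n) (s≤s a<b) (s≤s b<c) (s≤s c≤n)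
  (T₁ , _ , size-T₁ , _ , (_ , rot) , δσ≡τ) =
  Sum.map (cong suc) (cong suc)
    (jump-δ⇒1-transposition (pre-unique 0 T₁) a<b b<c c≤length (rotation⇒jump rot 0) δσ≡τ)
  where
  c≤length : c ≤ length (perm T₁)
  c≤length = subst (c ≤_) (sym (trans (length-pre 0 T₁) size-T₁)) c≤n

spine : ℕ → Tree → Tree
spine zero    t = t
spine (suc a) t = node leaf (spine a t)

comb : ℕ → Tree
comb a = spine a leaf

size-spine : ∀ a t → size (spine a t) ≡ a + size t
size-spine zero    t = refl
size-spine (suc a) t = cong suc (size-spine a t)

size-comb : ∀ a → size (comb a) ≡ a
size-comb a = trans (size-spine a leaf) (+-identityʳ a)

pre-spine : ∀ a o t → pre o (spine a t) ≡ pre o (comb a) ++ pre (o + a) t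
pre-spine zero    o t = cong (λ q → pre q t) (sym (+-identityʳ o))
pre-spine (suc a) o t rewrite +-identityʳ o =
  cong (suc o ∷_) (trans (pre-spine a (suc o) t) (cong (λ q → pre (suc o) (comb a) ++ pre q t) (sym (+-suc o a))))

rotation-spine : ∀ a → Rotation t u → Rotation (spine a t) (spine a u)
rotation-spine zero    rot = rot
rotation-spine (suc a) rot = inR leaf (rotation-spine a rot)

spine-witnesses : ∀ a c e →
  TreeTransposition (suc (suc a) + c + e) (suc a) (suc (suc a)) (suc (suc (suc a)) + c) ×
  TreeTransposition (suc (suc a) + c + e) (suc a) (suc (suc a) + c) (suc (suc (suc a) + c))
spine-witnesses a c e with pre-rotation a (comb c) leaf (comb e)
... | r , V , R , length-V , pre₁ , pre₂ =
  (T₁ , T₂ , size-T₁ , size-T₂ , (rotation-irreflexive rot , rot) , swap-forward) ,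
  (T₂ , T₁ , size-T₂ , size-T₁ , (rotation-irreflexive (rotation-sym rot) , rotation-sym rot) , swap-backward)
  where
  T₁ T₂ : Tree
  T₁ = spine a (node (node (comb c) leaf) (comb e))
  T₂ = spine a (node (comb c) (node leaf (comb e)))
  rot : Rotation T₁ T₂
  rot = rotation-spine a (rotR (comb c) leaf (comb e))
  P : List ℕ
  P = pre 0 (comb a)
  i≡ : suc a ≡ suc (length P)
  i≡ = cong suc (sym (trans (length-pre 0 (comb a)) (size-comb a)))
  length-V′ : length V ≡ suc c
  length-V′ = trans length-V (cong suc (size-comb c))
  perm-T₁ : perm T₁ ≡ P ++ (r ∷ []) ++ V ++ R
  perm-T₁ = trans (pre-spine a 0 _) (cong (P ++_) pre₁)
  perm-T₂ : perm T₂ ≡ P ++ V ++ (r ∷ []) ++ R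
  perm-T₂ = trans (pre-spine a 0 _) (cong (P ++_) pre₂)
  swap-forward : δ (suc a) (suc (suc a)) (suc (suc (suc a)) + c) (perm T₁) ≡ perm T₂
  swap-forward = trans (δ-swaps-blocks P (r ∷ []) V R perm-T₁ i≡ (sym (+-comm (suc a) 1))
    (trans (sym (+-suc (suc (suc a)) c)) (cong (suc (suc a) +_) (sym length-V′)))) (sym perm-T₂)
  swap-backward : δ (suc a) (suc (suc a) + c) (suc (suc (suc a) + c)) (perm T₂) ≡ perm T₁
  swap-backward = trans (δ-swaps-blocks P V (r ∷ []) R perm-T₂ i≡
    (trans (sym (+-suc (suc a) c)) (cong (suc a +_) (sym length-V′))) (sym (+-comm (suc (suc a) + c) 1)))
    (sym perm-T₁)
  size-T₁ : size T₁ ≡ suc (suc a) + c + e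
  size-T₁ = trans (size-spine a _)
    (trans (cong₂ (λ c′ e′ → a + suc (suc (c′ + 0) + e′)) (size-comb c) (size-comb e)) (arith a c e))
    where
    arith : ∀ a c e → a + suc (suc (c + 0) + e) ≡ suc (suc a) + c + e
    arith = solve-∀
  size-T₂ : size T₂ ≡ suc (suc a) + c + e
  size-T₂ = trans (sym (size-rotation rot)) size-T₁

1-transposition⇒tree-transposition : 1 ≤ i → i < j → j < k → k ≤ suc n →
  j ≡ suc i ⊎ k ≡ suc j → TreeTransposition n i j k
1-transposition⇒tree-transposition {suc a} (s≤s z≤n) i<j j<k k≤1+n (inj₁ refl)
  with m≤n⇒∃[o]m+o≡n j<k | m≤n⇒∃[o]m+o≡n k≤1+n
... | c , refl | e , k+e≡1+n =
  subst (λ m → TreeTransposition m (suc a) (suc (suc a)) (suc (suc (suc a)) + c))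
        (suc-injective k+e≡1+n) (proj₁ (spine-witnesses a c e))
1-transposition⇒tree-transposition {suc a} (s≤s z≤n) i<j j<k k≤1+n (inj₂ refl)
  with m≤n⇒∃[o]m+o≡n i<j | m≤n⇒∃[o]m+o≡n k≤1+n
... | c , refl | e , k+e≡1+n =
  subst (λ m → TreeTransposition m (suc a) (suc (suc a) + c) (suc (suc (suc a) + c)))
        (suc-injective k+e≡1+n) (proj₂ (spine-witnesses a c e))

theorem6 : (n : ℕ) → 1 ≤ n → (i j k : ℕ) → 1 ≤ i → i < j → j < k → k ≤ suc n →
    (TreeTransposition n i j k ⇔ (j ≡ suc i ⊎ k ≡ suc j))
theorem6 n _ i j k 1≤i i<j j<k k≤1+n =
  mk⇔ (tree-transposition⇒1-transposition 1≤i i<j j<k k≤1+n)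
      (1-transposition⇒tree-transposition 1≤i i<j j<k k≤1+n)
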